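{- Let $t_1$ and $t_2$ be regular terms in the language $\langle\to,\neg,{}^+,{}^-,1\rangle$ of strong quasi-Wajsberg* algebras. Then $t_1\approx t_2$ holds in all strong quasi-Wajsberg* algebras if and only if it holds in all Wajsberg* algebras.
   Context: A quasi-Wajsberg* algebra is an algebra $\langle W;\to,\neg,{}^+,{}^-,1\rangle$ of type $\langle2,1,1,1,0\rangle$ such that for all $x,y,z$: (QW*1) $x\to y=\neg y\to\neg x$; (QW*2) $(x\to1)\to((y\to1)\to z)=(y\to1)\to((x\to1)\to z)$; (QW*3) $(1\to x)\to1=1$; (QW*4) $(z\to z)\to(x\to y)=x\to y$; (QW*5) $(1\to1)\to x^+=((1\to1)\to x)^+=(x\to1)\to1$ and $(1\to1)\to x^-=((1\to1)\to x)^-=(x\to\neg1)\to\neg1$; (QW*6) $x\to y=(y^+\to x^-)\to(x^+\to y^-)$; (QW*7) $\neg(x\to y)=y\to x$; (QW*8) $\neg\neg x=x$; (QW*9) $(x\to(\neg x\to y))^+=x^+\to(\neg x^+\to y^+)$; (QW*10)–(QW*12) $\vee$ is commutative, associative, and $x\to(y\vee z)=(x\to y)\vee(x\to z)$; where $x\vee y:=((x^+\to y^+)^+\to(\neg x)^-)\to((y^-\to x^-)^-\to x^-)$. It is strong if $x^+=(1\to1)\to x^+$ and $x^-=(1\to1)\to x^-$ for all $x$. A Wajsberg* algebra is an algebra $\langle M;\to,\neg,1\rangle$ of type $\langle2,1,0\rangle$ satisfying for all $x,y,z$: $x\to y=\neg y\to\neg x$; $(x\to1)\to((y\to1)\to z)=(y\to1)\to((x\to1)\to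 z)$; $(1\to x)\to1=1$; $(y\to y)\to x=x$; $x\to y=(y^+\to x^-)\to(x^+\to y^-)$; $\neg(x\to y)=y\to x$; $\neg\neg x=x$; $(x\to(\neg x\to y))^+=x^+\to(\neg x^+\to y^+)$; $\vee$ commutative and associative; $x\to(y\vee z)=(x\to y)\vee(x\to z)$; where $x^+:=(x\to1)\to1$, $x^-:=(x\to\neg1)\to\neg1$. Wajsberg* algebras are regarded as algebras in the language $\langle\to,\neg,{}^+,{}^-,1\rangle$ with these term operations; so regarded, they are strong quasi-Wajsberg* algebras. A term is regular if it contains an occurrence of $\to$ or of $1$. -}

module Defs where

open import Level using (Level; suc; _⊔_)
open import Data.Nat using (ℕ)
open import Relation.Binary.PropositionalEquality using (_≡_)

data Term : Set where
  var  : ℕ → Term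
  _⇒ₜ_ : Term → Term → Term
  ~ₜ_  : Term → Term
  _⁺ₜ  : Term → Term
  _⁻ₜ  : Term → Term
  1ₜ   : Term

-- A term is regular if it contains an occurrence of → or of 1.
data Regular : Term → Set where
  reg-⇒  : ∀ {s t} → Regular (s ⇒ₜ t)
  reg-1  : Regular 1ₜ
  reg-~  : ∀ {t} → Regular t → Regular (~ₜ t)
  reg-⁺  : ∀ {t} → Regular t → Regular (t ⁺ₜ)
  reg-⁻  : ∀ {t} → Regular t → Regular (t ⁻ₜ)

record QWOps (ℓ : Level) : Set (suc ℓ) where
  infixr 5 _⇒_
  field
    Carrier : Set ℓ
    _⇒_     : Carrier → Carrier → Carrier
    ~_      : Carrier → Carrier
    _⁺      : Carrier → Carrier
    _⁻      : Carrier → Carrier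
    𝟏       : Carrier

  _∨_ : Carrier → Carrier → Carrier
  x ∨ y = (((x ⁺ ⇒ y ⁺) ⁺) ⇒ ((~ x) ⁻)) ⇒ ((((y ⁻ ⇒ x ⁻) ⁻) ⇒ (x ⁻)))

record IsQuasiWajsberg* {ℓ} (A : QWOps ℓ) : Set ℓ where
  open QWOps A
  field
    qw1  : ∀ x y → x ⇒ y ≡ (~ y) ⇒ (~ x)
    qw2  : ∀ x y z → (x ⇒ 𝟏) ⇒ ((y ⇒ 𝟏) ⇒ z) ≡ (y ⇒ 𝟏) ⇒ ((x ⇒ 𝟏) ⇒ z)
    qw3  : ∀ x → (𝟏 ⇒ x) ⇒ 𝟏 ≡ 𝟏
    qw4  : ∀ x y z → (z ⇒ z) ⇒ (x ⇒ y) ≡ x ⇒ y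
    qw5a : ∀ x → (𝟏 ⇒ 𝟏) ⇒ (x ⁺) ≡ ((𝟏 ⇒ 𝟏) ⇒ x) ⁺
    qw5b : ∀ x → ((𝟏 ⇒ 𝟏) ⇒ x) ⁺ ≡ (x ⇒ 𝟏) ⇒ 𝟏
    qw5c : ∀ x → (𝟏 ⇒ 𝟏) ⇒ (x ⁻) ≡ ((𝟏 ⇒ 𝟏) ⇒ x) ⁻
    qw5d : ∀ x → ((𝟏 ⇒ 𝟏) ⇒ x) ⁻ ≡ (x ⇒ ~ 𝟏) ⇒ ~ 𝟏
    qw6  : ∀ x y → x ⇒ y ≡ ((y ⁺) ⇒ (x ⁻)) ⇒ ((x ⁺) ⇒ (y ⁻))
    qw7  : ∀ x y → ~ (x ⇒ y) ≡ y ⇒ x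
    qw8  : ∀ x → ~ (~ x) ≡ x
    qw9  : ∀ x y → (x ⇒ ((~ x) ⇒ y)) ⁺ ≡ (x ⁺) ⇒ ((~ (x ⁺)) ⇒ (y ⁺))
    qw10 : ∀ x y → x ∨ y ≡ y ∨ x
    qw11 : ∀ x y z → x ∨ (y ∨ z) ≡ (x ∨ y) ∨ z
    qw12 : ∀ x y z → x ⇒ (y ∨ z) ≡ (x ⇒ y) ∨ (x ⇒ z)

record IsStrongQuasiWajsberg* {ℓ} (A : QWOps ℓ) : Set ℓ where
  open QWOps A
  field
    isQuasiWajsberg* : IsQuasiWajsberg* A
    strong⁺ : ∀ x → x ⁺ ≡ (𝟏 ⇒ 𝟏) ⇒ (x ⁺)
    strong⁻ : ∀ x → x ⁻ ≡ (𝟏 ⇒ 𝟏) ⇒ (x ⁻)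

record WOps (ℓ : Level) : Set (suc ℓ) where
  infixr 5 _⇒_
  field
    Carrier : Set ℓ
    _⇒_     : Carrier → Carrier → Carrier
    ~_      : Carrier → Carrier
    𝟏       : Carrier

toQWOps : ∀ {ℓ} → WOps ℓ → QWOps ℓ
toQWOps A = record
  { Carrier = Carrier
  ; _⇒_ = _⇒_
  ; ~_ = ~_
  ; _⁺ = λ x → (x ⇒ 𝟏) ⇒ 𝟏
  ; _⁻ = λ x → (x ⇒ ~ 𝟏) ⇒ ~ 𝟏
  ; 𝟏 = 𝟏
  }
  where open WOps A

record IsWajsberg* {ℓ} (A : WOps ℓ) : Set ℓ where
  open QWOps (toQWOps A)
  field
    w1  : ∀ x y → x ⇒ y ≡ (~ y) ⇒ (~ x)
    w2  : ∀ x y z → (x ⇒ 𝟏) ⇒ ((y ⇒ 𝟏) ⇒ z) ≡ (y ⇒ 𝟏) ⇒ ((x ⇒ 𝟏) ⇒ z)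
    w3  : ∀ x → (𝟏 ⇒ x) ⇒ 𝟏 ≡ 𝟏
    w4  : ∀ x y → (y ⇒ y) ⇒ x ≡ x
    w5  : ∀ x y → x ⇒ y ≡ ((y ⁺) ⇒ (x ⁻)) ⇒ ((x ⁺) ⇒ (y ⁻))
    w6  : ∀ x y → ~ (x ⇒ y) ≡ y ⇒ x
    w7  : ∀ x → ~ (~ x) ≡ x
    w8  : ∀ x y → (x ⇒ ((~ x) ⇒ y)) ⁺ ≡ (x ⁺) ⇒ ((~ (x ⁺)) ⇒ (y ⁺))
    w9  : ∀ x y → x ∨ y ≡ y ∨ x
    w10 : ∀ x y z → x ∨ (y ∨ z) ≡ (x ∨ y) ∨ z
    w11 : ∀ x y z → x ⇒ (y ∨ z) ≡ (x ⇒ y) ∨ (x ⇒ z)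

eval : ∀ {ℓ} (A : QWOps ℓ) → Term → (ℕ → QWOps.Carrier A) → QWOps.Carrier A
eval A (var n)  ρ = ρ n
eval A (s ⇒ₜ t) ρ = QWOps._⇒_ A (eval A s ρ) (eval A t ρ)
eval A (~ₜ t)   ρ = QWOps.~_ A (eval A t ρ)
eval A (t ⁺ₜ)   ρ = QWOps._⁺ A (eval A t ρ)
eval A (t ⁻ₜ)   ρ = QWOps._⁻ A (eval A t ρ)
eval A 1ₜ       ρ = QWOps.𝟏 A

_⊨_≈_ : ∀ {ℓ} (A : QWOps ℓ) → Term → Term → Set ℓ
A ⊨ t₁ ≈ t₂ = (ρ : ℕ → QWOps.Carrier A) → eval A t₁ ρ ≡ eval A t₂ ρ

HoldsInAllStrongQW* : (ℓ : Level) → Term → Term → Set (suc ℓ)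
HoldsInAllStrongQW* ℓ t₁ t₂ =
  (A : QWOps ℓ) → IsStrongQuasiWajsberg* A → A ⊨ t₁ ≈ t₂

HoldsInAllW* : (ℓ : Level) → Term → Term → Set (suc ℓ)
HoldsInAllW* ℓ t₁ t₂ =
  (A : WOps ℓ) → IsWajsberg* A → toQWOps A ⊨ t₁ ≈ t₂

-- A Wajsberg* algebra is a strong quasi-Wajsberg* algebra, which gives one
-- direction. Conversely, in a strong quasi-Wajsberg* algebra A the operations
-- ⁺ and ⁻ are the Wajsberg* term operations, and the fixed points of
-- x ↦ (1 → 1) → x form a Wajsberg* algebra onto which this map is a
-- retraction preserving →, ¬ and 1. Values of regular terms are such fixed
-- points, so an identity between regular terms valid in that algebra is
-- valid in A.
module Submission where

open import Defs
open import Level using (Level; _⊔_)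
open import Function using (_∘_)
open import Data.Product using (_×_; _,_; Σ; proj₁; proj₂)
open import Relation.Binary.PropositionalEquality
open import Axiom.UniquenessOfIdentityProofs.WithK using (uip)

toQWOps-isStrongQuasiWajsberg* : ∀ {ℓ} {W : WOps ℓ} →
  IsWajsberg* W → IsStrongQuasiWajsberg* (toQWOps W)
toQWOps-isStrongQuasiWajsberg* {W = W} isW = record
  { isQuasiWajsberg* = record
    { qw1 = w1 ; qw2 = w2 ; qw3 = w3
    ; qw4 = λ x y z → w4 (x ⇒ y) z
    ; qw5a = λ x → trans (w4 _ 𝟏) (cong (λ u → (u ⇒ 𝟏) ⇒ 𝟏) (sym (w4 x 𝟏)))
    ; qw5b = λ x → cong (λ u → (u ⇒ 𝟏) ⇒ 𝟏) (w4 x 𝟏)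
    ; qw5c = λ x → trans (w4 _ 𝟏) (cong (λ u → (u ⇒ ~ 𝟏) ⇒ ~ 𝟏) (sym (w4 x 𝟏)))
    ; qw5d = λ x → cong (λ u → (u ⇒ ~ 𝟏) ⇒ ~ 𝟏) (w4 x 𝟏)
    ; qw6 = w5 ; qw7 = w6 ; qw8 = w7 ; qw9 = w8
    ; qw10 = w9 ; qw11 = w10 ; qw12 = w11
    }
  ; strong⁺ = λ _ → sym (w4 _ 𝟏)
  ; strong⁻ = λ _ → sym (w4 _ 𝟏)
  }
  where
  open WOps W
  open IsWajsberg* isW

reduct : ∀ {ℓ} → QWOps ℓ → WOps ℓ
reduct A = record { Carrier = Carrier ; _⇒_ = _⇒_ ; ~_ = ~_ ; 𝟏 = 𝟏 }
  where open QWOps A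

module _ {ℓ} (A : QWOps ℓ) where
  open QWOps A
  private module R = QWOps (toQWOps (reduct A))

  module _ (⁺-def : ∀ x → x ⁺ ≡ (x ⇒ 𝟏) ⇒ 𝟏)
           (⁻-def : ∀ x → x ⁻ ≡ (x ⇒ ~ 𝟏) ⇒ ~ 𝟏) where

    eval-toQWOps-reduct : ∀ t ρ → eval A t ρ ≡ eval (toQWOps (reduct A)) t ρ
    eval-toQWOps-reduct (var n)  ρ = refl
    eval-toQWOps-reduct (s ⇒ₜ t) ρ =
      cong₂ _⇒_ (eval-toQWOps-reduct s ρ) (eval-toQWOps-reduct t ρ)
    eval-toQWOps-reduct (~ₜ t)   ρ = cong ~_ (eval-toQWOps-reduct t ρ)
    eval-toQWOps-reduct (t ⁺ₜ)   ρ =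
      trans (⁺-def _) (cong R._⁺ (eval-toQWOps-reduct t ρ))
    eval-toQWOps-reduct (t ⁻ₜ)   ρ =
      trans (⁻-def _) (cong R._⁻ (eval-toQWOps-reduct t ρ))
    eval-toQWOps-reduct 1ₜ       ρ = refl

    ∨-toQWOps-reduct : ∀ x y → x ∨ y ≡ x R.∨ y
    ∨-toQWOps-reduct x y =
      cong₂ _⇒_
        (cong₂ _⇒_ (⁺-cong (cong₂ _⇒_ (⁺-def x) (⁺-def y))) (⁻-def (~ x)))
        (cong₂ _⇒_ (⁻-cong (cong₂ _⇒_ (⁻-def y) (⁻-def x))) (⁻-def x))
      where
      ⁺-cong : ∀ {x y} → x ≡ y → x ⁺ ≡ y R.⁺
      ⁺-cong {x} refl = ⁺-def x
      ⁻-cong : ∀ {x y} → x ≡ y → x ⁻ ≡ y R.⁻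
      ⁻-cong {x} refl = ⁻-def x

record IsHomomorphism {a b} (A : WOps a) (B : WOps b)
                      (h : WOps.Carrier A → WOps.Carrier B) : Set (a ⊔ b) where
  module A = WOps A
  module B = WOps B
  field
    ⇒-homo : ∀ x y → h (x A.⇒ y) ≡ h x B.⇒ h y
    ~-homo : ∀ x → h (A.~ x) ≡ B.~ (h x)
    𝟏-homo : h A.𝟏 ≡ B.𝟏

  ⇒𝟏-homo : ∀ x → h (x A.⇒ A.𝟏) ≡ h x B.⇒ B.𝟏
  ⇒𝟏-homo x = trans (⇒-homo x A.𝟏) (cong (h x B.⇒_) 𝟏-homo)

  ⇒~𝟏-homo : ∀ x → h (x A.⇒ A.~ A.𝟏) ≡ h x B.⇒ B.~ B.𝟏
  ⇒~𝟏-homo x = trans (⇒-homo x _) (cong (h x B.⇒_) (trans (~-homo A.𝟏) (cong B.~_ 𝟏-homo)))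

  ⁺-homo : ∀ x → h ((x A.⇒ A.𝟏) A.⇒ A.𝟏) ≡ (h x B.⇒ B.𝟏) B.⇒ B.𝟏
  ⁺-homo x = trans (⇒𝟏-homo _) (cong (B._⇒ B.𝟏) (⇒𝟏-homo x))

  ⁻-homo : ∀ x → h ((x A.⇒ A.~ A.𝟏) A.⇒ A.~ A.𝟏) ≡ (h x B.⇒ B.~ B.𝟏) B.⇒ B.~ B.𝟏
  ⁻-homo x = trans (⇒~𝟏-homo _) (cong (B._⇒ B.~ B.𝟏) (⇒~𝟏-homo x))

  eval-homo : ∀ t ρ → h (eval (toQWOps A) t ρ) ≡ eval (toQWOps B) t (h ∘ ρ)
  eval-homo (var n)  ρ = refl
  eval-homo (s ⇒ₜ t) ρ = trans (⇒-homo _ _) (cong₂ B._⇒_ (eval-homo s ρ) (eval-homo t ρ))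
  eval-homo (~ₜ t)   ρ = trans (~-homo _) (cong B.~_ (eval-homo t ρ))
  eval-homo (t ⁺ₜ)   ρ =
    trans (⁺-homo _) (cong (λ u → (u B.⇒ B.𝟏) B.⇒ B.𝟏) (eval-homo t ρ))
  eval-homo (t ⁻ₜ)   ρ =
    trans (⁻-homo _) (cong (λ u → (u B.⇒ B.~ B.𝟏) B.⇒ B.~ B.𝟏) (eval-homo t ρ))
  eval-homo 1ₜ       ρ = 𝟏-homo

module StrongQuasiWajsberg* {ℓ} (A : QWOps ℓ) (isStrong : IsStrongQuasiWajsberg* A) where
  open QWOps A
  open IsStrongQuasiWajsberg* isStrong
  open IsQuasiWajsberg* isQuasiWajsberg*

  e : Carrier
  e = 𝟏 ⇒ 𝟏

  ⁺-def : ∀ x → x ⁺ ≡ (x ⇒ 𝟏) ⇒ 𝟏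
  ⁺-def x = trans (strong⁺ x) (trans (qw5a x) (qw5b x))

  ⁻-def : ∀ x → x ⁻ ≡ (x ⇒ ~ 𝟏) ⇒ ~ 𝟏
  ⁻-def x = trans (strong⁻ x) (trans (qw5c x) (qw5d x))

  e⇒-⁺ : ∀ x → (e ⇒ x) ⁺ ≡ x ⁺
  e⇒-⁺ x = trans (sym (qw5a x)) (sym (strong⁺ x))

  e⇒-⁻ : ∀ x → (e ⇒ x) ⁻ ≡ x ⁻
  e⇒-⁻ x = trans (sym (qw5c x)) (sym (strong⁻ x))

  e⇒-⇒ : ∀ x y → e ⇒ (x ⇒ y) ≡ x ⇒ y
  e⇒-⇒ x y = qw4 x y 𝟏

  e⇒-𝟏 : e ⇒ 𝟏 ≡ 𝟏
  e⇒-𝟏 = qw3 𝟏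

  e⇒-~ : ∀ x → e ⇒ ~ x ≡ ~ (e ⇒ x)
  e⇒-~ x = begin
    e ⇒ ~ x           ≡⟨ qw1 e (~ x) ⟩
    ~ ~ x ⇒ ~ e       ≡⟨ cong₂ _⇒_ (qw8 x) (qw7 𝟏 𝟏) ⟩
    x ⇒ e             ≡⟨ sym (qw7 e x) ⟩
    ~ (e ⇒ x)         ∎
    where open ≡-Reasoning

  -- (QW*6) expresses x → y through x⁺, x⁻, y⁺, y⁻ only, which e ⇒_ leaves unchanged.
  e⇒-⇒-e⇒ : ∀ x y → (e ⇒ x) ⇒ (e ⇒ y) ≡ x ⇒ y
  e⇒-⇒-e⇒ x y = begin
    (e ⇒ x) ⇒ (e ⇒ y)
      ≡⟨ qw6 (e ⇒ x) (e ⇒ y) ⟩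
    ((e ⇒ y) ⁺ ⇒ (e ⇒ x) ⁻) ⇒ ((e ⇒ x) ⁺ ⇒ (e ⇒ y) ⁻)
      ≡⟨ cong₂ _⇒_ (cong₂ _⇒_ (e⇒-⁺ y) (e⇒-⁻ x)) (cong₂ _⇒_ (e⇒-⁺ x) (e⇒-⁻ y)) ⟩
    (y ⁺ ⇒ x ⁻) ⇒ (x ⁺ ⇒ y ⁻)
      ≡⟨ sym (qw6 x y) ⟩
    x ⇒ y ∎
    where open ≡-Reasoning

  e⇒-regular : ∀ {t} → Regular t → ∀ ρ → e ⇒ eval A t ρ ≡ eval A t ρ
  e⇒-regular reg-⇒     ρ = e⇒-⇒ _ _
  e⇒-regular reg-1     ρ = e⇒-𝟏
  e⇒-regular (reg-~ r) ρ = trans (e⇒-~ _) (cong ~_ (e⇒-regular r ρ))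
  e⇒-regular (reg-⁺ r) ρ = sym (strong⁺ _)
  e⇒-regular (reg-⁻ r) ρ = sym (strong⁻ _)

  Fixed : Set ℓ
  Fixed = Σ Carrier (λ x → e ⇒ x ≡ x)

  Fixed-≡ : {x y : Fixed} → proj₁ x ≡ proj₁ y → x ≡ y
  Fixed-≡ {x , p} {.x , q} refl = cong (x ,_) (uip p q)

  fixedPart : WOps ℓ
  fixedPart = record
    { Carrier = Fixed
    ; _⇒_ = λ x y → proj₁ x ⇒ proj₁ y , e⇒-⇒ _ _
    ; ~_ = λ x → ~ proj₁ x , trans (e⇒-~ _) (cong ~_ (proj₂ x))
    ; 𝟏 = 𝟏 , e⇒-𝟏
    }

  private module M = QWOps (toQWOps fixedPart)

  proj₁-∨ : ∀ x y → proj₁ (x M.∨ y) ≡ proj₁ x ∨ proj₁ y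
  proj₁-∨ x y = sym (∨-toQWOps-reduct A ⁺-def ⁻-def (proj₁ x) (proj₁ y))

  fixedPart-isWajsberg* : IsWajsberg* fixedPart
  fixedPart-isWajsberg* = record
    { w1 = λ x y → Fixed-≡ (qw1 (proj₁ x) (proj₁ y))
    ; w2 = λ x y z → Fixed-≡ (qw2 (proj₁ x) (proj₁ y) (proj₁ z))
    ; w3 = λ x → Fixed-≡ (qw3 (proj₁ x))
    ; w4 = λ { (x , p) (y , _) → Fixed-≡ (trans (cong ((y ⇒ y) ⇒_) (sym p)) (trans (qw4 e x y) p)) }
    ; w5 = λ x y → Fixed-≡ (trans (qw6 (proj₁ x) (proj₁ y))
        (cong₂ _⇒_ (cong₂ _⇒_ (⁺-def _) (⁻-def _)) (cong₂ _⇒_ (⁺-def _) (⁻-def _))))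
    ; w6 = λ x y → Fixed-≡ (qw7 (proj₁ x) (proj₁ y))
    ; w7 = λ x → Fixed-≡ (qw8 (proj₁ x))
    ; w8 = λ x y → Fixed-≡ (trans (sym (⁺-def _)) (trans (qw9 (proj₁ x) (proj₁ y))
        (cong₂ _⇒_ (⁺-def _) (cong₂ _⇒_ (cong ~_ (⁺-def _)) (⁺-def _)))))
    ; w9 = λ x y → Fixed-≡ (trans (proj₁-∨ x y) (trans (qw10 _ _) (sym (proj₁-∨ y x))))
    ; w10 = λ x y z → Fixed-≡ (begin
        proj₁ (x M.∨ (y M.∨ z))                 ≡⟨ proj₁-∨ x (y M.∨ z) ⟩
        proj₁ x ∨ proj₁ (y M.∨ z)               ≡⟨ cong (proj₁ x ∨_) (proj₁-∨ y z) ⟩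
        proj₁ x ∨ (proj₁ y ∨ proj₁ z)           ≡⟨ qw11 _ _ _ ⟩
        (proj₁ x ∨ proj₁ y) ∨ proj₁ z           ≡⟨ cong (_∨ proj₁ z) (sym (proj₁-∨ x y)) ⟩
        proj₁ (x M.∨ y) ∨ proj₁ z               ≡⟨ sym (proj₁-∨ (x M.∨ y) z) ⟩
        proj₁ ((x M.∨ y) M.∨ z)                 ∎)
    ; w11 = λ x y z → Fixed-≡ (begin
        proj₁ x ⇒ proj₁ (y M.∨ z)               ≡⟨ cong (proj₁ x ⇒_) (proj₁-∨ y z) ⟩
        proj₁ x ⇒ (proj₁ y ∨ proj₁ z)           ≡⟨ qw12 _ _ _ ⟩
        (proj₁ x ⇒ proj₁ y) ∨ (proj₁ x ⇒ proj₁ z) ≡⟨ sym (proj₁-∨ (x M.⇒ y) (x M.⇒ z)) ⟩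
        proj₁ ((x M.⇒ y) M.∨ (x M.⇒ z))         ∎)
    }
    where open ≡-Reasoning

  retract : Carrier → Fixed
  retract x = e ⇒ x , e⇒-⇒ e x

  retract-isHomomorphism : IsHomomorphism (reduct A) fixedPart retract
  retract-isHomomorphism = record
    { ⇒-homo = λ x y → Fixed-≡ (trans (e⇒-⇒ x y) (sym (e⇒-⇒-e⇒ x y)))
    ; ~-homo = λ x → Fixed-≡ (e⇒-~ x)
    ; 𝟏-homo = Fixed-≡ e⇒-𝟏
    }

  retract-eval : ∀ t ρ → retract (eval A t ρ) ≡ eval (toQWOps fixedPart) t (retract ∘ ρ)
  retract-eval t ρ = trans (cong retract (eval-toQWOps-reduct A ⁺-def ⁻-def t ρ))
                           (IsHomomorphism.eval-homo retract-isHomomorphism t ρ)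

  regular-identity : ∀ {t₁ t₂} → Regular t₁ → Regular t₂ →
    toQWOps fixedPart ⊨ t₁ ≈ t₂ → A ⊨ t₁ ≈ t₂
  regular-identity {t₁} {t₂} r₁ r₂ fixed⊨ ρ = begin
    eval A t₁ ρ                                         ≡⟨ sym (e⇒-regular r₁ ρ) ⟩
    proj₁ (retract (eval A t₁ ρ))                       ≡⟨ cong proj₁ (retract-eval t₁ ρ) ⟩
    proj₁ (eval (toQWOps fixedPart) t₁ (retract ∘ ρ))   ≡⟨ cong proj₁ (fixed⊨ (retract ∘ ρ)) ⟩
    proj₁ (eval (toQWOps fixedPart) t₂ (retract ∘ ρ))   ≡⟨ cong proj₁ (sym (retract-eval t₂ ρ)) ⟩
    proj₁ (retract (eval A t₂ ρ))                       ≡⟨ e⇒-regular r₂ ρ ⟩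
    eval A t₂ ρ                                         ∎
    where open ≡-Reasoning

proposition3p7 : ∀ {ℓ : Level} (t₁ t₂ : Term) → Regular t₁ → Regular t₂ →
    (HoldsInAllStrongQW* ℓ t₁ t₂ → HoldsInAllW* ℓ t₁ t₂) × (HoldsInAllW* ℓ t₁ t₂ → HoldsInAllStrongQW* ℓ t₁ t₂)
proposition3p7 t₁ t₂ r₁ r₂ =
  (λ strong⊨ W isW → strong⊨ (toQWOps W) (toQWOps-isStrongQuasiWajsberg* isW)) ,
  (λ W*⊨ A isStrong → let open StrongQuasiWajsberg* A isStrong in
     regular-identity r₁ r₂ (W*⊨ fixedPart fixedPart-isWajsberg*))
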